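{- Let $\mathbf{A}$ be a countable homogeneous structure and let $f$ be a self-embedding of $\mathbf{A}$. If $\operatorname{im}(f)$ (as a substructure of $\mathbf{A}$) is superhomogeneous in $\mathbf{A}$, then $B(f)$ is dense in $\operatorname{Aut}(\mathbf{A})$.
   Context: $\operatorname{Aut}(\mathbf{A})$ carries the topology of pointwise convergence. $B(f):=\{\beta\in\operatorname{Aut}(\mathbf{A}):\exists\alpha\in\operatorname{Aut}(\mathbf{A})\ \alpha\circ f=f\circ\beta\}$. A structure $\mathbf{U}$ is homogeneous if every isomorphism between finitely generated substructures of $\mathbf{U}$ (a local isomorphism) extends to an automorphism of $\mathbf{U}$. A substructure $\mathbf{V}\le\mathbf{U}$ is superhomogeneous in $\mathbf{U}$ if (1) every local isomorphism of $\mathbf{V}$ extends to an automorphism of $\mathbf{U}$ whose restriction to $V$ is an automorphism of $\mathbf{V}$, and (2) for every $y\in U\setminus V$ there is $\alpha\in\operatorname{Aut}(\mathbf{U})$ fixing $V$ pointwise with $\alpha(y)\ne y$. -}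

module Defs where

open import Data.Nat using (ℕ)
open import Data.List using (List)
open import Data.List.Membership.Propositional using (_∈_)
open import Data.Vec using (Vec; map)
open import Data.Vec.Relation.Unary.All using (All)
open import Data.Product using (Σ; ∃; _×_; _,_)
open import Relation.Binary.PropositionalEquality using (_≡_; _≢_)
open import Relation.Nullary using (¬_)
open import Function.Definitions using (Injective; Bijective)
open import Function.Bundles using (_⇔_)

record Signature : Set₁ where
  field
    FunSym   : Set
    funArity : FunSym → ℕ
    RelSym   : Set
    relArity : RelSym → ℕ

record Structure (Σs : Signature) : Set₁ where
  open Signature Σs
  field
    Carrier : Set
    fun     : (F : FunSym) → Vec Carrier (funArity F) → Carrier
    rel     : (R : RelSym) → Vec Carrier (relArity R) → Set

module _ {Σs : Signature} (𝐀 : Structure Σs) where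
  open Signature Σs
  open Structure 𝐀

  -- countable: injects into ℕ (finite or countably infinite)
  Countable : Set
  Countable = Σ (Carrier → ℕ) λ c → Injective _≡_ _≡_ c

  IsSubstructure : (Carrier → Set) → Set
  IsSubstructure P = ∀ F (xs : Vec Carrier (funArity F)) → All P xs → P (fun F xs)

  data Gen (S : List Carrier) : Carrier → Set where
    base : ∀ {x} → x ∈ S → Gen S x
    app  : ∀ F (xs : Vec Carrier (funArity F)) → All (Gen S) xs → Gen S (fun F xs)

  IsIsoBetween : (Carrier → Set) → (Carrier → Set) → (Carrier → Carrier) → Set
  IsIsoBetween P Q h =
      (∀ x → P x → Q (h x))
    × (∀ x y → P x → P y → h x ≡ h y → x ≡ y)
    × (∀ y → Q y → ∃ λ x → P x × h x ≡ y)
    × (∀ F (xs : Vec Carrier (funArity F)) → All P xs → h (fun F xs) ≡ fun F (map h xs))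
    × (∀ R (xs : Vec Carrier (relArity R)) → All P xs → rel R xs ⇔ rel R (map h xs))

  IsLocalIso : List Carrier → List Carrier → (Carrier → Carrier) → Set
  IsLocalIso S T h = IsIsoBetween (Gen S) (Gen T) h

  IsAut : (Carrier → Carrier) → Set
  IsAut g =
      Bijective _≡_ _≡_ g
    × (∀ F (xs : Vec Carrier (funArity F)) → g (fun F xs) ≡ fun F (map g xs))
    × (∀ R (xs : Vec Carrier (relArity R)) → rel R xs ⇔ rel R (map g xs))

  IsEmbedding : (Carrier → Carrier) → Set
  IsEmbedding g =
      Injective _≡_ _≡_ g
    × (∀ F (xs : Vec Carrier (funArity F)) → g (fun F xs) ≡ fun F (map g xs))
    × (∀ R (xs : Vec Carrier (relArity R)) → rel R xs ⇔ rel R (map g xs))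

  Extends : (Carrier → Set) → (Carrier → Carrier) → (Carrier → Carrier) → Set
  Extends P α h = ∀ x → P x → α x ≡ h x

  Homogeneous : Set
  Homogeneous = ∀ S T h → IsLocalIso S T h → ∃ λ α → IsAut α × Extends (Gen S) α h

  Superhomogeneous : (Carrier → Set) → Set
  Superhomogeneous V =
      (∀ S T h → All′ S → All′ T → IsLocalIso S T h →
         ∃ λ α → IsAut α × Extends (Gen S) α h
               × (∀ x → V x → V (α x)) × (∀ y → V y → ∃ λ x → V x × α x ≡ y))
    × (∀ y → ¬ V y → ∃ λ α → IsAut α × (∀ x → V x → α x ≡ x) × α y ≢ y)
    where
      All′ : List Carrier → Set
      All′ S = ∀ {x} → x ∈ S → V x

  Im : (Carrier → Carrier) → Carrier → Set
  Im f y = ∃ λ x → f x ≡ y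

  InB : (Carrier → Carrier) → (Carrier → Carrier) → Set
  InB f β = IsAut β × ∃ λ α → IsAut α × (∀ x → α (f x) ≡ f (β x))

  -- density of a set of automorphisms in Aut(𝐀) w.r.t. pointwise convergence:
  -- every basic open set {β ∈ Aut | β agrees with γ on finite F} (γ ∈ Aut) meets it.
  DenseInAut : ((Carrier → Carrier) → Set) → Set
  DenseInAut X = ∀ γ → IsAut γ → (F : List Carrier) →
    ∃ λ β → X β × (∀ {x} → x ∈ F → β x ≡ γ x)

module Submission where

-- Fix an automorphism γ and a finite set F; we need β ∈ B(f) agreeing with γ
-- on F.  By homogeneity, the local isomorphism f↾⟨F⟩ : ⟨F⟩ → ⟨f F⟩ extends to
-- an automorphism φ.  The composite h = f ∘ γ ∘ φ⁻¹ is an embedding with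
-- h (f x) = f (γ x) for x ∈ F, hence a local isomorphism ⟨f F⟩ → ⟨f (γ F)⟩
-- between finitely generated substructures of im f.  Superhomogeneity of im f
-- extends h to an automorphism α mapping im f onto itself, and such an α
-- pulls back along f to an automorphism β = f⁻¹ ∘ α ∘ f; then α ∘ f = f ∘ β
-- puts β in B(f), and β x = γ x on F because f is injective.

open import Defs
open import Data.Product using (_×_; _,_; proj₁; proj₂; Σ; ∃)
open import Data.List as List using (List)
open import Data.List.Properties as ListP using (map-cong-local)
import Data.List.Relation.Unary.All as ListAll
open import Data.List.Membership.Propositional using (_∈_)
open import Data.List.Membership.Propositional.Properties using (∈-map⁺; ∈-map⁻)
open import Data.Vec as Vec using (Vec; map)
open import Data.Vec.Properties using (map-∘; map-cong; map-id)
open import Data.Vec.Relation.Unary.All using (All; []; _∷_)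
open import Relation.Binary.PropositionalEquality
open import Function.Bundles using (_⇔_)
import Function.Properties.Equivalence as ⇔
open import Function using (_∘_)

module Facts {Σs : Signature} (𝐀 : Structure Σs) where
  open Signature Σs
  open Structure 𝐀

  PreservesOps : (Carrier → Carrier) → Set
  PreservesOps g = ∀ F (xs : Vec Carrier (funArity F)) → g (fun F xs) ≡ fun F (map g xs)

  PreservesRels : (Carrier → Carrier) → Set
  PreservesRels g = ∀ R (xs : Vec Carrier (relArity R)) → rel R xs ⇔ rel R (map g xs)

  rel-≡ : ∀ R {xs ys : Vec Carrier (relArity R)} → xs ≡ ys → rel R xs ⇔ rel R ys
  rel-≡ R refl = ⇔.refl

  mutual
    gen-image : ∀ {g S x} → PreservesOps g → Gen 𝐀 S x → Gen 𝐀 (List.map g S) (g x)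
    gen-image {g} p (base x∈S)  = base (∈-map⁺ g x∈S)
    gen-image {g} p (app F xs gs) =
      subst (Gen 𝐀 _) (sym (p F xs)) (app F (map g xs) (gen-image-all p gs))

    gen-image-all : ∀ {g S n} {xs : Vec Carrier n} → PreservesOps g →
      All (Gen 𝐀 S) xs → All (Gen 𝐀 (List.map g S)) (map g xs)
    gen-image-all p []       = []
    gen-image-all p (x∈ ∷ xs∈) = gen-image p x∈ ∷ gen-image-all p xs∈

  mutual
    gen-preimage : ∀ {g S y} → PreservesOps g → Gen 𝐀 (List.map g S) y →
      ∃ λ x → Gen 𝐀 S x × g x ≡ y
    gen-preimage {g} p (base y∈gS) with ∈-map⁻ g y∈gS
    ... | x , x∈S , y≡gx = x , base x∈S , sym y≡gx
    gen-preimage {g} p (app F ys gs) with gen-preimage-all p gs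
    ... | xs , gxs , gxs≡ys = fun F xs , app F xs gxs , trans (p F xs) (cong (fun F) gxs≡ys)

    gen-preimage-all : ∀ {g S n} {ys : Vec Carrier n} → PreservesOps g →
      All (Gen 𝐀 (List.map g S)) ys →
      Σ (Vec Carrier n) λ xs → All (Gen 𝐀 S) xs × map g xs ≡ ys
    gen-preimage-all p []       = Vec.[] , [] , refl
    gen-preimage-all p (y∈ ∷ ys∈) with gen-preimage p y∈ | gen-preimage-all p ys∈
    ... | x , gx , e | xs , gxs , es = x Vec.∷ xs , gx ∷ gxs , cong₂ Vec._∷_ e es

  embedding⇒localIso : ∀ {g} S → IsEmbedding 𝐀 g → IsLocalIso 𝐀 S (List.map g S) g
  embedding⇒localIso S (inj , ops , rels) =
    (λ _ → gen-image ops) , (λ _ _ _ _ → inj) , (λ _ → gen-preimage ops) ,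
    (λ F xs _ → ops F xs) , (λ R xs _ → rels R xs)

  ∘-embedding : ∀ {g k} → IsEmbedding 𝐀 g → IsEmbedding 𝐀 k → IsEmbedding 𝐀 (g ∘ k)
  ∘-embedding {g} {k} (g-inj , g-ops , g-rels) (k-inj , k-ops , k-rels) =
    k-inj ∘ g-inj ,
    (λ F xs → begin
      g (k (fun F xs))             ≡⟨ cong g (k-ops F xs) ⟩
      g (fun F (map k xs))         ≡⟨ g-ops F (map k xs) ⟩
      fun F (map g (map k xs))     ≡⟨ cong (fun F) (sym (map-∘ g k xs)) ⟩
      fun F (map (g ∘ k) xs)       ∎) ,
    (λ R xs → ⇔.trans (k-rels R xs)
                (⇔.trans (g-rels R (map k xs)) (rel-≡ R (sym (map-∘ g k xs)))))
    where open ≡-Reasoning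

  module Inverse {g} (g-aut : IsAut 𝐀 g) where
    inv : Carrier → Carrier
    inv y = proj₁ (proj₂ (proj₁ g-aut) y)

    g∘inv : ∀ y → g (inv y) ≡ y
    g∘inv y = proj₂ (proj₂ (proj₁ g-aut) y) refl

    inv∘g : ∀ x → inv (g x) ≡ x
    inv∘g x = proj₁ (proj₁ g-aut) (g∘inv (g x))

    map-g∘inv : ∀ {n} (xs : Vec Carrier n) → map g (map inv xs) ≡ xs
    map-g∘inv xs = trans (sym (map-∘ g inv xs)) (trans (map-cong g∘inv xs) (map-id xs))

    inv-embedding : IsEmbedding 𝐀 inv
    inv-embedding =
      (λ {x} {y} e → trans (sym (g∘inv x)) (trans (cong g e) (g∘inv y))) ,
      (λ F xs → g-inj (begin
        g (inv (fun F xs))             ≡⟨ g∘inv (fun F xs) ⟩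
        fun F xs                       ≡⟨ cong (fun F) (sym (map-g∘inv xs)) ⟩
        fun F (map g (map inv xs))     ≡⟨ sym (g-ops F (map inv xs)) ⟩
        g (fun F (map inv xs))         ∎)) ,
      (λ R xs → ⇔.sym (⇔.trans (g-rels R (map inv xs)) (rel-≡ R (map-g∘inv xs))))
      where
      open ≡-Reasoning
      g-inj : ∀ {x y} → g x ≡ g y → x ≡ y
      g-inj = proj₁ (proj₁ g-aut)
      g-ops : PreservesOps g
      g-ops = proj₁ (proj₂ g-aut)
      g-rels : PreservesRels g
      g-rels = proj₂ (proj₂ g-aut)

  aut⇒embedding : ∀ {g} → IsAut 𝐀 g → IsEmbedding 𝐀 g
  aut⇒embedding ((inj , _) , ops , rels) = inj , ops , rels

  -- Pull-back along an embedding f: an automorphism α mapping im f onto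
  -- itself induces the automorphism β = f⁻¹ ∘ α ∘ f, i.e. α ∘ f = f ∘ β.
  module PullBack {f α} (f-emb : IsEmbedding 𝐀 f) (α-aut : IsAut 𝐀 α)
      (into : ∀ y → Im 𝐀 f y → Im 𝐀 f (α y))
      (onto : ∀ y → Im 𝐀 f y → ∃ λ x → Im 𝐀 f x × α x ≡ y) where
    private
      f-inj : ∀ {x y} → f x ≡ f y → x ≡ y
      f-inj = proj₁ f-emb
      f-ops : PreservesOps f
      f-ops = proj₁ (proj₂ f-emb)
      f-rels : PreservesRels f
      f-rels = proj₂ (proj₂ f-emb)
      α-inj : ∀ {x y} → α x ≡ α y → x ≡ y
      α-inj = proj₁ (proj₁ α-aut)
      α-ops : PreservesOps α
      α-ops = proj₁ (proj₂ α-aut)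
      α-rels : PreservesRels α
      α-rels = proj₂ (proj₂ α-aut)

    β : Carrier → Carrier
    β x = proj₁ (into (f x) (x , refl))

    f∘β : ∀ x → f (β x) ≡ α (f x)
    f∘β x = proj₂ (into (f x) (x , refl))

    map-f∘β : ∀ {n} (xs : Vec Carrier n) → map f (map β xs) ≡ map α (map f xs)
    map-f∘β xs = trans (sym (map-∘ f β xs)) (trans (map-cong f∘β xs) (map-∘ α f xs))

    -- Surjectivity of β uses that α maps im f onto im f.
    β-preimage : ∀ y → ∃ λ x → β x ≡ y
    β-preimage y with onto (f y) (y , refl)
    ... | _ , (w , fw≡x) , αx≡fy = w , f-inj (trans (f∘β w) (trans (cong α fw≡x) αx≡fy))

    β-aut : IsAut 𝐀 β
    β-aut =
      ((λ {x} {y} e → f-inj (α-inj (trans (sym (f∘β x)) (trans (cong f e) (f∘β y))))) ,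
       (λ y → proj₁ (β-preimage y) , λ {z} z≡x → trans (cong β z≡x) (proj₂ (β-preimage y)))) ,
      (λ F xs → f-inj (begin
        f (β (fun F xs))             ≡⟨ f∘β (fun F xs) ⟩
        α (f (fun F xs))             ≡⟨ cong α (f-ops F xs) ⟩
        α (fun F (map f xs))         ≡⟨ α-ops F (map f xs) ⟩
        fun F (map α (map f xs))     ≡⟨ cong (fun F) (sym (map-f∘β xs)) ⟩
        fun F (map f (map β xs))     ≡⟨ sym (f-ops F (map β xs)) ⟩
        f (fun F (map β xs))         ∎)) ,
      (λ R xs → ⇔.trans (f-rels R xs) (⇔.trans (α-rels R (map f xs))
                  (⇔.trans (rel-≡ R (sym (map-f∘β xs))) (⇔.sym (f-rels R (map β xs))))))
      where open ≡-Reasoning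

  ∈-map⇒Im : ∀ {f} (S : List Carrier) {y} → y ∈ List.map f S → Im 𝐀 f y
  ∈-map⇒Im {f} S y∈fS with ∈-map⁻ f y∈fS
  ... | x , _ , y≡fx = x , sym y≡fx

  -- Homogeneity transports γ↾F into im f: there is a local isomorphism
  -- h : ⟨f F⟩ → ⟨f (γ F)⟩ with h (f x) = f (γ x) for x ∈ F, namely
  -- h = f ∘ γ ∘ φ⁻¹ for an automorphism φ extending f↾⟨F⟩.
  transported-localIso : Homogeneous 𝐀 → ∀ {f γ} → IsEmbedding 𝐀 f → IsAut 𝐀 γ →
    (F : List Carrier) →
    ∃ λ h → IsLocalIso 𝐀 (List.map f F) (List.map f (List.map γ F)) h
          × (∀ {x} → x ∈ F → h (f x) ≡ f (γ x))
  transported-localIso hom {f} {γ} f-emb γ-aut F with hom F (List.map f F) f (embedding⇒localIso F f-emb)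
  ... | φ , φ-aut , φ-ext = h , h-localIso , h-on-fF
    where
    open Inverse φ-aut
    h : Carrier → Carrier
    h = f ∘ γ ∘ inv

    h-on-fF : ∀ {x} → x ∈ F → h (f x) ≡ f (γ x)
    h-on-fF {x} x∈F = cong (f ∘ γ) (trans (cong inv (sym (φ-ext x (base x∈F)))) (inv∘g x))

    h-fF : List.map h (List.map f F) ≡ List.map f (List.map γ F)
    h-fF = trans (sym (ListP.map-∘ F))
                 (trans (map-cong-local (ListAll.tabulate h-on-fF)) (ListP.map-∘ F))

    h-localIso : IsLocalIso 𝐀 (List.map f F) (List.map f (List.map γ F)) h
    h-localIso = subst (λ T → IsLocalIso 𝐀 (List.map f F) T h) h-fF
      (embedding⇒localIso (List.map f F)
        (∘-embedding f-emb (∘-embedding (aut⇒embedding γ-aut) inv-embedding)))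

open Facts

lemma3p10 : {Σs : Signature} (𝐀 : Structure Σs) →
    Countable 𝐀 → Homogeneous 𝐀 →
    (f : Structure.Carrier 𝐀 → Structure.Carrier 𝐀) → IsEmbedding 𝐀 f →
    Superhomogeneous 𝐀 (Im 𝐀 f) →
    DenseInAut 𝐀 (InB 𝐀 f)
lemma3p10 𝐀 _ hom f f-emb (extend , _) γ γ-aut F
  with transported-localIso 𝐀 hom f-emb γ-aut F
... | h , h-localIso , h-on-fF
  with extend (List.map f F) (List.map f (List.map γ F)) h
         (∈-map⇒Im 𝐀 F) (∈-map⇒Im 𝐀 (List.map γ F)) h-localIso
... | α , α-aut , α-ext , into , onto =
  β , (β-aut , α , α-aut , sym ∘ f∘β) , β-agrees
  where
  open PullBack 𝐀 f-emb α-aut into onto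
  -- β x = γ x on F, since f (β x) = α (f x) = h (f x) = f (γ x).
  β-agrees : ∀ {x} → x ∈ F → β x ≡ γ x
  β-agrees {x} x∈F =
    proj₁ f-emb (trans (f∘β x) (trans (α-ext (f x) (base (∈-map⁺ f x∈F))) (h-on-fF x∈F)))
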